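{- Let $p$ be an odd prime and $\mathbf{C}^{(p)}=(c_i)_{i\ge0}$ the $p$-Cantor sequence. For every nonnegative integer $k$ and every $0\le i\le p^k-1$, $c_i=c_{p^k-1-i}$.
   Context: $p_2=(p-1)/2$. For real $a,b$, $\binom{a}{b}=\frac{a!}{b!(a-b)!}$ if $a,b$ are nonnegative integers with $a\ge b$, and $0$ otherwise. The $p$-Cantor sequence: let $\phi_p$ be the substitution on $\{0,1,\dots,p-1\}$ (identified with $\mathbb{F}_p$) sending each letter $n$ to the length-$p$ word whose $i$-th letter ($0\le i\le p-1$) is $n\binom{p_2}{i/2}\bmod p$, extended to words by concatenation; $\mathbf{C}^{(p)}=(c_i)_{i\ge0}=\lim_{k\to\infty}\phi_p^k(1)$, a sequence over $\mathbb{F}_p$. -}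

module Defs where

open import Data.Nat using (ℕ; zero; suc; _+_; _*_; _^_; _%_; _/_; NonZero)
open import Data.Nat.Combinatorics using (_C_)
open import Data.List using (List; []; _∷_; map; concatMap; upTo; lookup; length)

-- half-binomial  binom(a, i/2) with i/2 real: nonzero only when i is even
-- (then i/2 is a natural number) and i/2 ≤ a.  Note ℕ's _C_ is 0 when k > n.
halfBinom : ℕ → ℕ → ℕ
halfBinom a i with i % 2
... | zero  = a C (i / 2)
... | suc _ = 0

p₂ : ℕ → ℕ
p₂ p = (p Data.Nat.∸ 1) / 2

-- letters of F_p represented as naturals in [0,p)
-- φ_p on a single letter n : the length-p word (n * binom(p₂, i/2) mod p)_{0≤i<p}
φ-letter : (p : ℕ) .{{_ : NonZero p}} → ℕ → List ℕ
φ-letter p n = map (λ i → (n * halfBinom (p₂ p) i) % p) (upTo p)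

φ : (p : ℕ) .{{_ : NonZero p}} → List ℕ → List ℕ
φ p = concatMap (φ-letter p)

φ^ : (p : ℕ) .{{_ : NonZero p}} → ℕ → List ℕ
φ^ p zero    = 1 ∷ []
φ^ p (suc k) = φ p (φ^ p k)

-- i-th letter of a word (0 if out of range; never used out of range below)
letter : List ℕ → ℕ → ℕ
letter [] _ = 0
letter (x ∷ xs) zero = x
letter (x ∷ xs) (suc i) = letter xs i

-- The p-Cantor sequence C^(p) = lim_k φ_p^k(1).  Since φ_p(1) starts with 1,
-- φ_p^k(1) is a prefix of φ_p^(k+1)(1) and has length p^k; so c_i is the
-- i-th letter of φ_p^k(1) for any k with p^k > i.  We take k = i + 1
-- (p^(i+1) > i for p ≥ 2).
cantor : (p : ℕ) .{{_ : NonZero p}} → ℕ → ℕ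
cantor p i = letter (φ^ p (suc i)) i

-- For odd p = 2p₂ + 1 the image φ_p(n) is a palindrome, since binom(p₂, i/2) is invariant
-- under i ↦ 2p₂ − i: odd positions carry 0, and on even ones this is binom(p₂, j) = binom(p₂, p₂ − j).
-- Reversing a concatenation of images concatenates the reversed images in reverse order, so
-- φ_p maps palindromes to palindromes and every φ_p^k(1), of length p^k, is a palindrome.
-- Because φ_p(1) starts with 1, each φ_p^k(1) is a prefix of the next, so c_i can be read off
-- any φ_p^k(1) with i < p^k.
module Submission where

open import Defs
open import Data.Nat using (ℕ; _%_; _^_; _∸_; _≤_; _+_; suc; NonZero)
open import Data.Nat.Primality using (Prime)
open import Relation.Binary.PropositionalEquality using (_≡_)

open import Data.Nat using (zero; _*_; _/_; _<_; _≤′_; ≤′-refl; ≤′-step; z<s; s<s; nonTrivial⇒n>1)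
open import Data.Nat.Properties
open import Data.Nat.DivMod using (m≡m%n+[m/n]*n; m*n%n≡0; m*n/n≡m; [m+kn]%n≡m%n; m<n⇒m%n≡m)
open import Data.Nat.Combinatorics using (_C_; nCk≡nC[n∸k])
open import Data.Nat.Primality using (prime)
open import Data.List using (List; []; _∷_; _++_; [_]; map; reverse; length; concatMap; upTo; applyUpTo; applyDownFrom)
open import Data.List.Properties
  using (++-identityʳ; concatMap-++; concatMap-cong; length-++; length-map; length-upTo;
         length-reverse; map-upTo; reverse-++; reverse-applyUpTo; unfold-reverse)
open import Data.Product using (∃-syntax; _,_)
open import Data.Sum using (inj₁; inj₂)
open import Function using (_∘_)
open import Relation.Binary.PropositionalEquality using (_≢_; refl; sym; trans; cong; cong₂; subst; module ≡-Reasoning)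
open import Data.Empty using (⊥-elim)

∸-suc-< : ∀ {n i} → i < n → n ∸ suc i < n
∸-suc-< i<n = ∸-monoʳ-< z<s i<n

n<m^n : ∀ m → 1 < m → ∀ n → n < m ^ n
n<m^n m 1<m zero    = z<s
n<m^n m 1<m (suc n) = ≤-<-trans (n<m^n m 1<m n) (^-monoʳ-< m 1<m (n<1+n n))

letter-++ˡ : ∀ xs ys {i} → i < length xs → letter (xs ++ ys) i ≡ letter xs i
letter-++ˡ (x ∷ xs) ys {zero}  _         = refl
letter-++ˡ (x ∷ xs) ys {suc i} (s<s i<n) = letter-++ˡ xs ys i<n

letter-++-length : ∀ xs y ys → letter (xs ++ y ∷ ys) (length xs) ≡ y
letter-++-length []       y ys = refl
letter-++-length (x ∷ xs) y ys = letter-++-length xs y ys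

letter-reverse : ∀ xs {i} → i < length xs → letter (reverse xs) (length xs ∸ suc i) ≡ letter xs i
letter-reverse (x ∷ xs) {zero} _ = begin
  letter (reverse (x ∷ xs)) (length xs)              ≡⟨ cong₂ letter (unfold-reverse x xs) (sym (length-reverse xs)) ⟩
  letter (reverse xs ++ [ x ]) (length (reverse xs)) ≡⟨ letter-++-length (reverse xs) x [] ⟩
  x                                                  ∎
  where open ≡-Reasoning
letter-reverse (x ∷ xs) {suc i} (s<s i<n) = begin
  letter (reverse (x ∷ xs)) (length xs ∸ suc i)   ≡⟨ cong (λ ys → letter ys (length xs ∸ suc i)) (unfold-reverse x xs) ⟩
  letter (reverse xs ++ [ x ]) (length xs ∸ suc i) ≡⟨ letter-++ˡ (reverse xs) [ x ] (subst (length xs ∸ suc i <_) (sym (length-reverse xs)) (∸-suc-< i<n)) ⟩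
  letter (reverse xs) (length xs ∸ suc i)         ≡⟨ letter-reverse xs i<n ⟩
  letter xs i                                     ∎
  where open ≡-Reasoning

Palindrome : {A : Set} → List A → Set
Palindrome xs = reverse xs ≡ xs

palindrome⇒letter-mirror : ∀ {xs n i} → Palindrome xs → length xs ≡ n → i < n →
  letter xs (n ∸ suc i) ≡ letter xs i
palindrome⇒letter-mirror {xs} {i = i} pal refl i<n =
  trans (cong (λ ys → letter ys (length xs ∸ suc i)) (sym pal)) (letter-reverse xs i<n)

applyDownFrom≡applyUpTo : ∀ {A : Set} (f : ℕ → A) n → applyDownFrom f n ≡ applyUpTo (λ i → f (n ∸ suc i)) n
applyDownFrom≡applyUpTo f zero    = refl
applyDownFrom≡applyUpTo f (suc n) = cong (f n ∷_) (applyDownFrom≡applyUpTo f n)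

applyUpTo-cong : ∀ {A : Set} {f g : ℕ → A} n → (∀ {i} → i < n → f i ≡ g i) → applyUpTo f n ≡ applyUpTo g n
applyUpTo-cong zero    f≗g = refl
applyUpTo-cong (suc n) f≗g = cong₂ _∷_ (f≗g z<s) (applyUpTo-cong n (f≗g ∘ s<s))

applyUpTo-palindrome : ∀ {A : Set} (f : ℕ → A) n → (∀ {i} → i < n → f (n ∸ suc i) ≡ f i) →
  Palindrome (applyUpTo f n)
applyUpTo-palindrome f n mirror = begin
  reverse (applyUpTo f n)              ≡⟨ reverse-applyUpTo f n ⟩
  applyDownFrom f n                    ≡⟨ applyDownFrom≡applyUpTo f n ⟩
  applyUpTo (λ i → f (n ∸ suc i)) n    ≡⟨ applyUpTo-cong n mirror ⟩
  applyUpTo f n                        ∎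
  where open ≡-Reasoning

reverse-concatMap : ∀ {A B : Set} (g : A → List B) xs →
  reverse (concatMap g xs) ≡ concatMap (reverse ∘ g) (reverse xs)
reverse-concatMap g []       = refl
reverse-concatMap g (x ∷ xs) = begin
  reverse (g x ++ concatMap g xs)
    ≡⟨ reverse-++ (g x) (concatMap g xs) ⟩
  reverse (concatMap g xs) ++ reverse (g x)
    ≡⟨ cong₂ _++_ (reverse-concatMap g xs) (sym (++-identityʳ _)) ⟩
  concatMap (reverse ∘ g) (reverse xs) ++ concatMap (reverse ∘ g) [ x ]
    ≡⟨ concatMap-++ (reverse ∘ g) (reverse xs) [ x ] ⟨
  concatMap (reverse ∘ g) (reverse xs ++ [ x ])
    ≡⟨ cong (concatMap (reverse ∘ g)) (unfold-reverse x xs) ⟨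
  concatMap (reverse ∘ g) (reverse (x ∷ xs))
    ∎
  where open ≡-Reasoning

concatMap-palindrome : ∀ {A B : Set} (g : A → List B) {xs} → (∀ x → Palindrome (g x)) →
  Palindrome xs → Palindrome (concatMap g xs)
concatMap-palindrome g {xs} g-pal xs-pal = begin
  reverse (concatMap g xs)             ≡⟨ reverse-concatMap g xs ⟩
  concatMap (reverse ∘ g) (reverse xs) ≡⟨ cong (concatMap (reverse ∘ g)) xs-pal ⟩
  concatMap (reverse ∘ g) xs           ≡⟨ concatMap-cong g-pal xs ⟩
  concatMap g xs                       ∎
  where open ≡-Reasoning

length-concatMap : ∀ {A B : Set} (g : A → List B) {c} → (∀ x → length (g x) ≡ c) → ∀ xs →
  length (concatMap g xs) ≡ length xs * c
length-concatMap g |g|≡c []       = refl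
length-concatMap g |g|≡c (x ∷ xs) =
  trans (length-++ (g x)) (cong₂ _+_ (|g|≡c x) (length-concatMap g |g|≡c xs))

data EvenOrOdd : ℕ → Set where
  even : ∀ j → EvenOrOdd (j * 2)
  odd  : ∀ j → EvenOrOdd (suc (j * 2))

evenOrOdd : ∀ n → EvenOrOdd n
evenOrOdd zero = even 0
evenOrOdd (suc n) with evenOrOdd n
... | even j = odd j
... | odd j  = even (suc j)

odd≢even : ∀ m n → suc (m * 2) ≢ n * 2
odd≢even m n eq with trans (sym ([m+kn]%n≡m%n 1 m 2)) (trans (cong (_% 2) eq) (m*n%n≡0 n 2))
... | ()

m+n≡o⇒oCm≡oCn : ∀ m n {o} → m + n ≡ o → o C m ≡ o C n
m+n≡o⇒oCm≡oCn m n refl = trans (nCk≡nC[n∸k] (m≤m+n m n)) (cong ((m + n) C_) (m+n∸m≡n m n))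

halfBinom-even : ∀ a j → halfBinom a (j * 2) ≡ a C j
halfBinom-even a j with j * 2 % 2 | m*n%n≡0 j 2
... | _ | refl = cong (a C_) (m*n/n≡m j 2)

halfBinom-odd : ∀ a j → halfBinom a (suc (j * 2)) ≡ 0
halfBinom-odd a j with suc (j * 2) % 2 | [m+kn]%n≡m%n 1 j 2
... | _ | refl = refl

halfBinom-sym : ∀ a i j → i + j ≡ a * 2 → halfBinom a i ≡ halfBinom a j
halfBinom-sym a i j i+j≡2a with evenOrOdd i | evenOrOdd j
... | even u | even v = begin
  halfBinom a (u * 2) ≡⟨ halfBinom-even a u ⟩
  a C u               ≡⟨ m+n≡o⇒oCm≡oCn u v (*-cancelʳ-≡ (u + v) a 2 (trans (*-distribʳ-+ 2 u v) i+j≡2a)) ⟩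
  a C v               ≡⟨ halfBinom-even a v ⟨
  halfBinom a (v * 2) ∎
  where open ≡-Reasoning
... | odd u  | odd v  = trans (halfBinom-odd a u) (sym (halfBinom-odd a v))
... | even u | odd v  = ⊥-elim (odd≢even (u + v) a (begin
  suc ((u + v) * 2)     ≡⟨ cong suc (*-distribʳ-+ 2 u v) ⟩
  suc (u * 2 + v * 2)   ≡⟨ +-suc (u * 2) (v * 2) ⟨
  u * 2 + suc (v * 2)   ≡⟨ i+j≡2a ⟩
  a * 2                 ∎))
  where open ≡-Reasoning
... | odd u  | even v = ⊥-elim (odd≢even (u + v) a (trans (cong suc (*-distribʳ-+ 2 u v)) i+j≡2a))

module _ (p : ℕ) .{{_ : NonZero p}} where

  length-φ-letter : ∀ n → length (φ-letter p n) ≡ p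
  length-φ-letter n = trans (length-map _ (upTo p)) (length-upTo p)

  length-φ^ : ∀ k → length (φ^ p k) ≡ p ^ k
  length-φ^ zero    = refl
  length-φ^ (suc k) = begin
    length (φ p (φ^ p k))   ≡⟨ length-concatMap (φ-letter p) length-φ-letter (φ^ p k) ⟩
    length (φ^ p k) * p     ≡⟨ cong (_* p) (length-φ^ k) ⟩
    p ^ k * p               ≡⟨ *-comm (p ^ k) p ⟩
    p * p ^ k               ∎
    where open ≡-Reasoning

φ-letter-1-head : ∀ p .{{_ : NonZero p}} → 1 < p → ∃[ t ] φ-letter p 1 ≡ 1 ∷ t
φ-letter-1-head (suc p) 1<p = _ , cong₂ _∷_ (m<n⇒m%n≡m 1<p) refl

module Stability (p : ℕ) .{{_ : NonZero p}} (1<p : 1 < p) where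

  φ^-suc-prefix : ∀ k → ∃[ t ] φ^ p (suc k) ≡ φ^ p k ++ t
  φ^-suc-prefix zero with φ-letter-1-head p 1<p
  ... | t , φ1≡1∷t = t ++ [] , cong (_++ []) φ1≡1∷t
  φ^-suc-prefix (suc k) with φ^-suc-prefix k
  ... | t , φ^sk≡φ^k++t = φ p t , trans (cong (φ p) φ^sk≡φ^k++t) (concatMap-++ (φ-letter p) (φ^ p k) t)

  letter-φ^-suc : ∀ {k i} → i < p ^ k → letter (φ^ p (suc k)) i ≡ letter (φ^ p k) i
  letter-φ^-suc {k} {i} i<p^k with φ^-suc-prefix k
  ... | t , φ^sk≡φ^k++t = trans (cong (λ w → letter w i) φ^sk≡φ^k++t)
                                (letter-++ˡ (φ^ p k) t (subst (i <_) (sym (length-φ^ p k)) i<p^k))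

  letter-φ^-stable : ∀ {k l i} → k ≤′ l → i < p ^ k → letter (φ^ p l) i ≡ letter (φ^ p k) i
  letter-φ^-stable ≤′-refl i<p^k = refl
  letter-φ^-stable {l = suc l} (≤′-step k≤′l) i<p^k =
    trans (letter-φ^-suc {l} (<-≤-trans i<p^k (^-monoʳ-≤ p (≤′⇒≤ k≤′l)))) (letter-φ^-stable k≤′l i<p^k)

  cantor≡letter-φ^ : ∀ k {i} → i < p ^ k → cantor p i ≡ letter (φ^ p k) i
  cantor≡letter-φ^ k {i} i<p^k with ≤-total k (suc i)
  ... | inj₁ k≤1+i = letter-φ^-stable (≤⇒≤′ k≤1+i) i<p^k
  ... | inj₂ 1+i≤k = sym (letter-φ^-stable (≤⇒≤′ 1+i≤k) (<⇒≤ (n<m^n p 1<p (suc i))))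

odd⇒≡1+p₂*2 : ∀ p → p % 2 ≡ 1 → p ≡ suc (p₂ p * 2)
odd⇒≡1+p₂*2 p p%2≡1 = trans p≡1+[p/2]*2 (cong (λ h → suc (h * 2)) (sym p₂≡p/2))
  where
  p≡1+[p/2]*2 : p ≡ suc (p / 2 * 2)
  p≡1+[p/2]*2 = trans (m≡m%n+[m/n]*n p 2) (cong (_+ p / 2 * 2) p%2≡1)
  p₂≡p/2 : p₂ p ≡ p / 2
  p₂≡p/2 = trans (cong (λ h → (h ∸ 1) / 2) p≡1+[p/2]*2) (m*n/n≡m (p / 2) 2)

module OddSubstitution (p : ℕ) .{{_ : NonZero p}} (p≡1+p₂*2 : p ≡ suc (p₂ p * 2)) where

  φ-letter-palindrome : ∀ n → Palindrome (φ-letter p n)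
  φ-letter-palindrome n = subst Palindrome (sym (map-upTo f p)) (applyUpTo-palindrome f p f-mirror)
    where
    f : ℕ → ℕ
    f i = (n * halfBinom (p₂ p) i) % p
    f-mirror : ∀ {i} → i < p → f (p ∸ suc i) ≡ f i
    f-mirror {i} i<p = cong (λ h → (n * h) % p)
      (sym (halfBinom-sym (p₂ p) i (p ∸ suc i) (suc-injective (trans (m+[n∸m]≡n i<p) p≡1+p₂*2))))

  φ^-palindrome : ∀ k → Palindrome (φ^ p k)
  φ^-palindrome zero    = refl
  φ^-palindrome (suc k) = concatMap-palindrome (φ-letter p) φ-letter-palindrome (φ^-palindrome k)

  letter-φ^-mirror : ∀ k {i} → i < p ^ k → letter (φ^ p k) (p ^ k ∸ suc i) ≡ letter (φ^ p k) i
  letter-φ^-mirror k = palindrome⇒letter-mirror (φ^-palindrome k) (length-φ^ p k)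

lemma3p4 : (p : ℕ) .{{_ : NonZero p}} → Prime p → p % 2 ≡ 1 →
    (k i : ℕ) → suc i ≤ p ^ k →
    cantor p i ≡ cantor p (p ^ k ∸ 1 ∸ i)
lemma3p4 p (prime _) p%2≡1 k i i<p^k = begin
  cantor p i                      ≡⟨ cantor≡letter-φ^ k i<p^k ⟩
  letter (φ^ p k) i               ≡⟨ letter-φ^-mirror k i<p^k ⟨
  letter (φ^ p k) (p ^ k ∸ suc i) ≡⟨ cantor≡letter-φ^ k (∸-suc-< i<p^k) ⟨
  cantor p (p ^ k ∸ suc i)        ≡⟨ cong (cantor p) (∸-+-assoc (p ^ k) 1 i) ⟨
  cantor p (p ^ k ∸ 1 ∸ i)        ∎
  where
  open ≡-Reasoning
  open Stability p (nonTrivial⇒n>1 p)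
  open OddSubstitution p (odd⇒≡1+p₂*2 p p%2≡1)
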